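{- Let $\mathcal{D}$ be the labelled calculus with the rules $(id),(\bot_l),(\wedge_l),(\wedge_r),(\vee_l),(\vee_r),(\supset_r),(\supset_l),(ref),(id^*),(\supset^*_l)$ (i.e. $\mathsf{G3Int}+\{(id^*),(\supset^*_l)\}-(tra)$). Then $(ref)$ is eliminable in $\mathcal{D}$: every labelled sequent derivable in $\mathcal{D}$ is derivable in $\mathcal{D}$ without any application of $(ref)$.
   Context: Propositional formulas: $A ::= p \mid \bot \mid (A\vee A)\mid (A\wedge A)\mid (A\supset A)$, $p$ ranging over propositional variables. Labelled sequents $\mathcal{R},\Gamma\Rightarrow\Delta$: $\mathcal{R}$ a multiset of relational atoms $w\le v$ ($w,v$ labels), $\Gamma,\Delta$ multisets of labelled formulas $w:A$; components may be empty. Rules: $(id)$: $\mathcal{R},w\le v,w:p,\Gamma\Rightarrow\Delta,v:p$; $(\bot_l)$: $\mathcal{R},w:\bot,\Gamma\Rightarrow\Delta$; $(\wedge_l)$: from $\mathcal{R},w:A,w:B,\Gamma\Rightarrow\Delta$ infer $\mathcal{R},w:A\wedge B,\Gamma\Rightarrow\Delta$; $(\wedge_r)$: from $\mathcal{R},\Gamma\Rightarrow\Delta,w:A$ and $\mathcal{R},\Gamma\Rightarrow\Delta,w:B$ infer $\mathcal{R},\Gamma\Rightarrow\Delta,w:A\wedge B$; $(\vee_l)$: from $\mathcal{R},w:A,\Gamma\Rightarrow\Delta$ and $\mathcal{R},w:B,\Gamma\Rightarrow\Delta$ infer $\mathcal{R},w:A\vee B,\Gamma\Rightarrow\Delta$;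 $(\vee_r)$: from $\mathcal{R},\Gamma\Rightarrow\Delta,w:A,w:B$ infer $\mathcal{R},\Gamma\Rightarrow\Delta,w:A\vee B$; $(\supset_r)$: from $\mathcal{R},w\le v,v:A,\Gamma\Rightarrow\Delta,v:B$ infer $\mathcal{R},\Gamma\Rightarrow\Delta,w:A\supset B$, provided $v$ does not occur in the conclusion; $(\supset_l)$: from $\mathcal{R},w\le v,w:A\supset B,\Gamma\Rightarrow\Delta,v:A$ and $\mathcal{R},w\le v,w:A\supset B,v:B,\Gamma\Rightarrow\Delta$ infer $\mathcal{R},w\le v,w:A\supset B,\Gamma\Rightarrow\Delta$; $(ref)$: from $\mathcal{R},w\le w,\Gamma\Rightarrow\Delta$ infer $\mathcal{R},\Gamma\Rightarrow\Delta$; $(id^*)$: $\mathcal{R},w:p,\Gamma\Rightarrow\Delta,w:p$; $(\supset^*_l)$: from $\mathcal{R},w:A\supset B,\Gamma\Rightarrow\Delta,w:A$ and $\mathcal{R},w:A\supset B,w:B,\Gamma\Rightarrow\Delta$ infer $\mathcal{R},w:A\supset B,\Gamma\Rightarrow\Delta$. -}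

module Defs where

open import Data.Nat using (ℕ)
open import Data.Bool using (Bool; true; false)
open import Data.List using (List; []; _∷_)
open import Data.List.Relation.Unary.All using (All)
open import Data.List.Relation.Binary.Permutation.Propositional using (_↭_)
open import Data.Product using (_×_; _,_)
open import Relation.Binary.PropositionalEquality using (_≡_; _≢_)

Var : Set
Var = ℕ

Label : Set
Label = ℕ

data Formula : Set where
  atom : Var → Formula
  ⊥'   : Formula
  _∨'_ : Formula → Formula → Formula
  _∧'_ : Formula → Formula → Formula
  _⊃'_ : Formula → Formula → Formula

record RelAtom : Set where
  constructor _≤ᵣ_
  field
    src : Label
    tgt : Label

record LFormula : Set where
  constructor _∶_
  field
    lab : Label
    fml : Formula

record Sequent : Set where
  constructor ⟨_∣_⇒_⟩
  field
    rel : List RelAtom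
    ant : List LFormula
    suc : List LFormula

NotInRel : Label → RelAtom → Set
NotInRel v (w ≤ᵣ u) = (v ≢ w) × (v ≢ u)

NotInLF : Label → LFormula → Set
NotInLF v (w ∶ _) = v ≢ w

Fresh : Label → Sequent → Set
Fresh v ⟨ R ∣ Γ ⇒ Δ ⟩ = All (NotInRel v) R × All (NotInLF v) Γ × All (NotInLF v) Δ

-- The Bool index says whether (ref) may be used:
-- Der true S  : S derivable in D;  Der false S : S derivable in D without (ref).
-- Principal formulas are displayed at the head of lists; since sequent
-- components are multisets, the rule `perm` identifies sequents up to
-- reordering (it is not a logical rule, only the multiset representation).
data Der (r : Bool) : Sequent → Set where
  perm : ∀ {R R' Γ Γ' Δ Δ'} → R ↭ R' → Γ ↭ Γ' → Δ ↭ Δ' →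
         Der r ⟨ R ∣ Γ ⇒ Δ ⟩ → Der r ⟨ R' ∣ Γ' ⇒ Δ' ⟩
  id   : ∀ {R Γ Δ w v p} →
         Der r ⟨ (w ≤ᵣ v) ∷ R ∣ (w ∶ atom p) ∷ Γ ⇒ (v ∶ atom p) ∷ Δ ⟩
  ⊥l   : ∀ {R Γ Δ w} → Der r ⟨ R ∣ (w ∶ ⊥') ∷ Γ ⇒ Δ ⟩
  ∧l   : ∀ {R Γ Δ w A B} →
         Der r ⟨ R ∣ (w ∶ A) ∷ (w ∶ B) ∷ Γ ⇒ Δ ⟩ →
         Der r ⟨ R ∣ (w ∶ (A ∧' B)) ∷ Γ ⇒ Δ ⟩
  ∧r   : ∀ {R Γ Δ w A B} →
         Der r ⟨ R ∣ Γ ⇒ (w ∶ A) ∷ Δ ⟩ → Der r ⟨ R ∣ Γ ⇒ (w ∶ B) ∷ Δ ⟩ →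
         Der r ⟨ R ∣ Γ ⇒ (w ∶ (A ∧' B)) ∷ Δ ⟩
  ∨l   : ∀ {R Γ Δ w A B} →
         Der r ⟨ R ∣ (w ∶ A) ∷ Γ ⇒ Δ ⟩ → Der r ⟨ R ∣ (w ∶ B) ∷ Γ ⇒ Δ ⟩ →
         Der r ⟨ R ∣ (w ∶ (A ∨' B)) ∷ Γ ⇒ Δ ⟩
  ∨r   : ∀ {R Γ Δ w A B} →
         Der r ⟨ R ∣ Γ ⇒ (w ∶ A) ∷ (w ∶ B) ∷ Δ ⟩ →
         Der r ⟨ R ∣ Γ ⇒ (w ∶ (A ∨' B)) ∷ Δ ⟩
  ⊃r   : ∀ {R Γ Δ w v A B} →
         Fresh v ⟨ R ∣ Γ ⇒ (w ∶ (A ⊃' B)) ∷ Δ ⟩ →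
         Der r ⟨ (w ≤ᵣ v) ∷ R ∣ (v ∶ A) ∷ Γ ⇒ (v ∶ B) ∷ Δ ⟩ →
         Der r ⟨ R ∣ Γ ⇒ (w ∶ (A ⊃' B)) ∷ Δ ⟩
  ⊃l   : ∀ {R Γ Δ w v A B} →
         Der r ⟨ (w ≤ᵣ v) ∷ R ∣ (w ∶ (A ⊃' B)) ∷ Γ ⇒ (v ∶ A) ∷ Δ ⟩ →
         Der r ⟨ (w ≤ᵣ v) ∷ R ∣ (w ∶ (A ⊃' B)) ∷ (v ∶ B) ∷ Γ ⇒ Δ ⟩ →
         Der r ⟨ (w ≤ᵣ v) ∷ R ∣ (w ∶ (A ⊃' B)) ∷ Γ ⇒ Δ ⟩
  ref  : ∀ {R Γ Δ w} → r ≡ true →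
         Der r ⟨ (w ≤ᵣ w) ∷ R ∣ Γ ⇒ Δ ⟩ → Der r ⟨ R ∣ Γ ⇒ Δ ⟩
  id*  : ∀ {R Γ Δ w p} →
         Der r ⟨ R ∣ (w ∶ atom p) ∷ Γ ⇒ (w ∶ atom p) ∷ Δ ⟩
  ⊃l*  : ∀ {R Γ Δ w A B} →
         Der r ⟨ R ∣ (w ∶ (A ⊃' B)) ∷ Γ ⇒ (w ∶ A) ∷ Δ ⟩ →
         Der r ⟨ R ∣ (w ∶ (A ⊃' B)) ∷ (w ∶ B) ∷ Γ ⇒ Δ ⟩ →
         Der r ⟨ R ∣ (w ∶ (A ⊃' B)) ∷ Γ ⇒ Δ ⟩

module Submission where

-- A reflexive atom w ≤ w can only be principal in (id) with w : p ⇒ w : p, or in (⊃l)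
-- with w : A ⊃ B on the left and w : A on the right; these instances are exactly
-- (id*) and (⊃l*). So every reflexive atom can be deleted from a (ref)-free derivation,
-- and each (ref) is removed by deleting the atom it introduces.

open import Defs
open import Data.Bool using (true; false)
open import Data.Nat using (_≟_)
open import Data.List using (_∷_; _++_)
open import Data.List.Relation.Unary.All using (tail)
open import Data.List.Relation.Unary.Any using (here; there)
open import Data.List.Membership.Propositional using (_∈_)
open import Data.List.Membership.Propositional.Properties using (∈-∃++)
open import Data.List.Relation.Binary.Permutation.Propositional
open import Data.List.Relation.Binary.Permutation.Propositional.Properties
  using (∈-resp-↭; All-resp-↭; shift)
open import Data.Product using (∃; _,_)
open import Data.Empty using (⊥-elim)
open import Relation.Binary.Definitions using (DecidableEquality)
open import Relation.Binary.PropositionalEquality using (_≡_; _≢_; refl)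
open import Relation.Nullary using (yes; no)

module _ {A : Set} where

  ∈⇒↭-∷ : ∀ {x : A} {xs} → x ∈ xs → ∃ λ ys → xs ↭ x ∷ ys
  ∈⇒↭-∷ {x} x∈xs with ys , zs , refl ← ∈-∃++ x∈xs = ys ++ zs , shift x ys zs

  ↭-∷-≢ : ∀ {x y : A} {xs ys} → x ≢ y → x ∷ xs ↭ y ∷ ys → ∃ λ zs → ys ↭ x ∷ zs
  ↭-∷-≢ x≢y p with ∈-resp-↭ p (here refl)
  ... | here x≡y = ⊥-elim (x≢y x≡y)
  ... | there x∈ys = ∈⇒↭-∷ x∈ys

_≟ᵣ_ : DecidableEquality RelAtom
(w ≤ᵣ v) ≟ᵣ (w' ≤ᵣ v') with w ≟ w' | v ≟ v'
... | yes refl | yes refl = yes refl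
... | no w≢w'  | _        = no λ { refl → w≢w' refl }
... | _        | no v≢v'  = no λ { refl → v≢v' refl }

reorder-rel : ∀ {r R R' Γ Δ} → R ↭ R' → Der r ⟨ R ∣ Γ ⇒ Δ ⟩ → Der r ⟨ R' ∣ Γ ⇒ Δ ⟩
reorder-rel σ = perm σ ↭-refl ↭-refl

drop-reflexive : ∀ {w R R' Γ Δ} → R ↭ (w ≤ᵣ w) ∷ R' →
                 Der false ⟨ R ∣ Γ ⇒ Δ ⟩ → Der false ⟨ R' ∣ Γ ⇒ Δ ⟩
drop-reflexive σ (perm ρ γ δ d) = perm ↭-refl γ δ (drop-reflexive (↭-trans ρ σ) d)
drop-reflexive {w} σ (id {w = u} {v = v}) with (u ≤ᵣ v) ≟ᵣ (w ≤ᵣ w)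
... | yes refl = id*
... | no ≢refl with R'' , τ ← ↭-∷-≢ ≢refl σ = reorder-rel (↭-sym τ) id
drop-reflexive σ ⊥l = ⊥l
drop-reflexive σ (∧l d) = ∧l (drop-reflexive σ d)
drop-reflexive σ (∧r d e) = ∧r (drop-reflexive σ d) (drop-reflexive σ e)
drop-reflexive σ (∨l d e) = ∨l (drop-reflexive σ d) (drop-reflexive σ e)
drop-reflexive σ (∨r d) = ∨r (drop-reflexive σ d)
drop-reflexive σ (⊃r (fresh-R , fresh-Γ , fresh-Δ) d) =
  ⊃r (tail (All-resp-↭ σ fresh-R) , fresh-Γ , fresh-Δ)
     (drop-reflexive (↭-trans (↭-prep _ σ) (↭-swap _ _ ↭-refl)) d)
drop-reflexive {w} σ (⊃l {w = u} {v = v} d e) with (u ≤ᵣ v) ≟ᵣ (w ≤ᵣ w)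
... | yes refl = ⊃l* (drop-reflexive σ d) (drop-reflexive σ e)
... | no ≢refl with R'' , τ ← ↭-∷-≢ ≢refl σ =
  reorder-rel (↭-sym τ) (⊃l (reorder-rel τ (drop-reflexive σ d)) (reorder-rel τ (drop-reflexive σ e)))
drop-reflexive σ (ref () d)
drop-reflexive σ id* = id*
drop-reflexive σ (⊃l* d e) = ⊃l* (drop-reflexive σ d) (drop-reflexive σ e)

eliminate-ref : ∀ {S} → Der true S → Der false S
eliminate-ref (perm ρ γ δ d) = perm ρ γ δ (eliminate-ref d)
eliminate-ref id = id
eliminate-ref ⊥l = ⊥l
eliminate-ref (∧l d) = ∧l (eliminate-ref d)
eliminate-ref (∧r d e) = ∧r (eliminate-ref d) (eliminate-ref e)
eliminate-ref (∨l d e) = ∨l (eliminate-ref d) (eliminate-ref e)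
eliminate-ref (∨r d) = ∨r (eliminate-ref d)
eliminate-ref (⊃r fresh d) = ⊃r fresh (eliminate-ref d)
eliminate-ref (⊃l d e) = ⊃l (eliminate-ref d) (eliminate-ref e)
eliminate-ref (ref _ d) = drop-reflexive ↭-refl (eliminate-ref d)
eliminate-ref id* = id*
eliminate-ref (⊃l* d e) = ⊃l* (eliminate-ref d) (eliminate-ref e)

lemma3 : ∀ S → Der true S → Der false S
lemma3 _ = eliminate-ref
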